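{- Let $G$ be a prereduced graph and let $X\subseteq V(G)$ induce either a hole, an asteroidal witness, or a path of length at least $2$. Then the set $\widehat N(X)$ of common neighbors of $X$ induces a clique.
   Context: Graphs are finite, simple, undirected. A hole is an induced cycle of length at least $4$. Three vertices form an asteroidal triple if each pair of them is connected by a path avoiding the closed neighborhood of the third. An asteroidal witness is a minimal induced subgraph that is not a hole and contains an asteroidal triple, while none of its proper induced subgraphs contains one. $\widehat N(X)$ denotes the set of vertices adjacent to every vertex of $X$. A minimal forbidden set is $X\subseteq V(G)$ such that $G[X]$ is not an interval graph but every proper subset induces an interval graph; $G$ is prereduced if it has no minimal forbidden set of at most $10$ vertices. -}

module Defs where

open import Data.Nat using (ℕ; suc; _≤_; _>_; _+_)
open import Data.Fin using (Fin; toℕ)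
open import Data.Fin.Subset using (Subset; _∈_; _⊂_; ∣_∣)
open import Data.Bool using (Bool; true; false)
open import Data.Product using (Σ; _×_; ∃; ∃-syntax)
open import Relation.Binary.PropositionalEquality using (_≡_; _≢_)
open import Relation.Nullary using (¬_)
open import Data.Sum using (_⊎_)
open import Function.Bundles using (_⇔_)

record Graph : Set where
  field
    n      : ℕ
    E      : Fin n → Fin n → Bool
    sym    : ∀ u v → E u v ≡ E v u
    irrefl : ∀ v → E v v ≡ false

CycSucc : (k : ℕ) → Fin k → Fin k → Set
CycSucc k i j = (suc (toℕ i) ≡ toℕ j) ⊎ (suc (toℕ i) ≡ k × toℕ j ≡ 0)

module _ (G : Graph) where
  open Graph G

  Adj : Fin n → Fin n → Set
  Adj u v = E u v ≡ true

  -- Walk from u to v all of whose vertices satisfy P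
  -- (existence of such a walk = existence of such a path).
  data Walk (P : Fin n → Set) : Fin n → Fin n → Set where
    here : ∀ {u} → P u → Walk P u u
    step : ∀ {u w v} → P u → Adj u w → Walk P w v → Walk P u v

  Avoid : Subset n → Fin n → Fin n → Set
  Avoid X z w = w ∈ X × w ≢ z × ¬ Adj z w

  IsAT : Subset n → Fin n → Fin n → Fin n → Set
  IsAT X a b c =
    a ∈ X × b ∈ X × c ∈ X × a ≢ b × b ≢ c × a ≢ c ×
    Walk (Avoid X c) a b × Walk (Avoid X a) b c × Walk (Avoid X b) a c

  HasAT : Subset n → Set
  HasAT X = ∃[ a ] ∃[ b ] ∃[ c ] IsAT X a b c

  Enumerates : (k : ℕ) → (Fin k → Fin n) → Subset n → Set
  Enumerates k c X =
    (∀ i j → c i ≡ c j → i ≡ j) × (∀ i → c i ∈ X) × (∀ v → v ∈ X → ∃[ i ] c i ≡ v)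

  IsHole : Subset n → Set
  IsHole X = ∃[ k ] Σ (Fin k → Fin n) λ c →
    4 ≤ k × Enumerates k c X ×
    (∀ i j → Adj (c i) (c j) ⇔ (CycSucc k i j ⊎ CycSucc k j i))

  -- G[X] is an induced path of length (number of edges) at least 2
  IsLongPath : Subset n → Set
  IsLongPath X = ∃[ k ] Σ (Fin k → Fin n) λ c →
    3 ≤ k × Enumerates k c X ×
    (∀ i j → Adj (c i) (c j) ⇔ ((suc (toℕ i) ≡ toℕ j) ⊎ (suc (toℕ j) ≡ toℕ i)))

  IsAsteroidalWitness : Subset n → Set
  IsAsteroidalWitness X = ¬ IsHole X × HasAT X × (∀ Y → Y ⊂ X → ¬ HasAT Y)

  IsInterval : Subset n → Set
  IsInterval X = Σ (Fin n → ℕ) λ l → Σ (Fin n → ℕ) λ r →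
    (∀ v → v ∈ X → l v ≤ r v) ×
    (∀ u v → u ∈ X → v ∈ X → u ≢ v → Adj u v ⇔ (l u ≤ r v × l v ≤ r u))

  IsMinimalForbidden : Subset n → Set
  IsMinimalForbidden X = ¬ IsInterval X × (∀ Y → Y ⊂ X → IsInterval Y)

  Prereduced : Set
  Prereduced = ∀ X → IsMinimalForbidden X → ∣ X ∣ > 10

  CommonNbr : Subset n → Fin n → Set
  CommonNbr X v = ∀ x → x ∈ X → Adj v x

  IsCliqueSet : (Fin n → Set) → Set
  IsCliqueSet S = ∀ u v → S u → S v → u ≢ v → Adj u v

-- X always contains two distinct nonadjacent vertices a and b (in an
-- asteroidal triple, a leaves the closed neighbourhood of b). If two common
-- neighbours u and v of X were nonadjacent, u a v b would be an induced 4-cycle.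
-- A 4-cycle is a minimal non-interval graph: in an interval model the disjoint
-- intervals of u and v are both met by the intervals of a and b, which then
-- overlap; deleting any vertex leaves a path on three vertices. Its four
-- vertices would be a minimal forbidden set, impossible in a prereduced graph.
module Submission where

open import Defs
open import Data.Bool as Bool using (if_then_else_)
open import Data.Empty using (⊥; ⊥-elim)
open import Data.Fin using (Fin; zero; suc; _≟_)
open import Data.Fin.Subset using (Subset; inside; outside; _∈_; _∉_; _∪_; ⁅_⁆; ∣_∣)
open import Data.Fin.Subset.Properties using (x∈p∪q⁻; x∈p∪q⁺; x∈⁅x⁆; x∈⁅y⁆⇒x≡y; ∣⁅x⁆∣≡1)
open import Data.Nat using (ℕ; suc; _≤_; _<_; _+_; z≤n; s≤s; _≤?_)
open import Data.Nat.Properties using (≤-trans; ≤-reflexive; n≤1+n; m≤n⇒m≤1+n; +-suc; ≰⇒>; <⇒≤)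
open import Data.Product using (_×_; _,_; proj₁; proj₂; ∃-syntax)
open import Data.Sum using (_⊎_; inj₁; inj₂; [_,_]; map₂)
open import Data.Vec using (_∷_; [])
open import Function using (_∘_)
open import Function.Bundles using (_⇔_; mk⇔; Equivalence)
open import Relation.Binary.PropositionalEquality using (_≡_; _≢_; refl; sym; trans; subst)
open import Relation.Nullary using (¬_; yes; no; does)
open import Relation.Nullary.Decidable using (dec-true; dec-false; from-no)

open Equivalence using (to; from)

∣p∪q∣≤∣p∣+∣q∣ : ∀ {n} (p q : Subset n) → ∣ p ∪ q ∣ ≤ ∣ p ∣ + ∣ q ∣
∣p∪q∣≤∣p∣+∣q∣ [] [] = z≤n
∣p∪q∣≤∣p∣+∣q∣ (inside ∷ p) (inside ∷ q) =
  s≤s (subst (∣ p ∪ q ∣ ≤_) (sym (+-suc ∣ p ∣ ∣ q ∣)) (m≤n⇒m≤1+n (∣p∪q∣≤∣p∣+∣q∣ p q)))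
∣p∪q∣≤∣p∣+∣q∣ (inside ∷ p) (outside ∷ q) = s≤s (∣p∪q∣≤∣p∣+∣q∣ p q)
∣p∪q∣≤∣p∣+∣q∣ (outside ∷ p) (inside ∷ q) =
  subst (suc ∣ p ∪ q ∣ ≤_) (sym (+-suc ∣ p ∣ ∣ q ∣)) (s≤s (∣p∪q∣≤∣p∣+∣q∣ p q))
∣p∪q∣≤∣p∣+∣q∣ (outside ∷ p) (outside ∷ q) = ∣p∪q∣≤∣p∣+∣q∣ p q

∣⁅x⁆∪p∣≤1+∣p∣ : ∀ {n} (x : Fin n) (p : Subset n) → ∣ ⁅ x ⁆ ∪ p ∣ ≤ suc ∣ p ∣
∣⁅x⁆∪p∣≤1+∣p∣ x p = subst (λ k → ∣ ⁅ x ⁆ ∪ p ∣ ≤ k + ∣ p ∣) (∣⁅x⁆∣≡1 x) (∣p∪q∣≤∣p∣+∣q∣ ⁅ x ⁆ p)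

x∈⁅y⁆∪p⁻ : ∀ {n} {x y : Fin n} (p : Subset n) → x ∈ ⁅ y ⁆ ∪ p → x ≡ y ⊎ x ∈ p
x∈⁅y⁆∪p⁻ {y = y} p x∈ with x∈p∪q⁻ ⁅ y ⁆ p x∈
... | inj₁ x∈⁅y⁆ = inj₁ (x∈⁅y⁆⇒x≡y y x∈⁅y⁆)
... | inj₂ x∈p = inj₂ x∈p

x∈⁅x⁆∪p : ∀ {n} (x : Fin n) (p : Subset n) → x ∈ ⁅ x ⁆ ∪ p
x∈⁅x⁆∪p x p = x∈p∪q⁺ (inj₁ (x∈⁅x⁆ x))

x∈p⇒x∈⁅y⁆∪p : ∀ {n} {x : Fin n} (y : Fin n) {p : Subset n} → x ∈ p → x ∈ ⁅ y ⁆ ∪ p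
x∈p⇒x∈⁅y⁆∪p _ x∈p = x∈p∪q⁺ (inj₂ x∈p)

module _ (G : Graph) where
  open Graph G using (n; E; irrefl) renaming (sym to E-sym)

  Adj-irrefl : ∀ {x y} → Adj G x y → x ≢ y
  Adj-irrefl {x} xy refl with () ← trans (sym (irrefl x)) xy

  Adj-sym : ∀ {x y} → Adj G x y → Adj G y x
  Adj-sym {x} {y} = trans (sym (E-sym x y))

  module _ {p q r : Fin n} (pq : Adj G p q) (qr : Adj G q r) (¬pr : ¬ Adj G p r) (p≢r : p ≢ r) where

    OnPath : Fin n → Set
    OnPath x = x ≡ p ⊎ x ≡ q ⊎ x ≡ r

    position : Fin n → ℕ
    position x = if does (x ≟ p) then 0 else if does (x ≟ q) then 1 else 2

    position-p : position p ≡ 0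
    position-p rewrite dec-true (p ≟ p) refl = refl

    position-q : position q ≡ 1
    position-q rewrite dec-false (q ≟ p) (Adj-irrefl pq ∘ sym) | dec-true (q ≟ q) refl = refl

    position-r : position r ≡ 2
    position-r rewrite dec-false (r ≟ p) (p≢r ∘ sym) | dec-false (r ≟ q) (Adj-irrefl qr ∘ sym) = refl

    Adj⇔unitOverlap : ∀ {x y} → OnPath x → OnPath y → x ≢ y →
      Adj G x y ⇔ (position x ≤ suc (position y) × position y ≤ suc (position x))
    Adj⇔unitOverlap (inj₁ refl) (inj₁ refl) x≢y = ⊥-elim (x≢y refl)
    Adj⇔unitOverlap (inj₂ (inj₁ refl)) (inj₂ (inj₁ refl)) x≢y = ⊥-elim (x≢y refl)
    Adj⇔unitOverlap (inj₂ (inj₂ refl)) (inj₂ (inj₂ refl)) x≢y = ⊥-elim (x≢y refl)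
    Adj⇔unitOverlap (inj₁ refl) (inj₂ (inj₁ refl)) _ rewrite position-p | position-q =
      mk⇔ (λ _ → z≤n , s≤s z≤n) (λ _ → pq)
    Adj⇔unitOverlap (inj₂ (inj₁ refl)) (inj₁ refl) _ rewrite position-p | position-q =
      mk⇔ (λ _ → s≤s z≤n , z≤n) (λ _ → Adj-sym pq)
    Adj⇔unitOverlap (inj₂ (inj₁ refl)) (inj₂ (inj₂ refl)) _ rewrite position-q | position-r =
      mk⇔ (λ _ → s≤s z≤n , s≤s (s≤s z≤n)) (λ _ → qr)
    Adj⇔unitOverlap (inj₂ (inj₂ refl)) (inj₂ (inj₁ refl)) _ rewrite position-q | position-r =
      mk⇔ (λ _ → s≤s (s≤s z≤n) , s≤s z≤n) (λ _ → Adj-sym qr)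
    Adj⇔unitOverlap (inj₁ refl) (inj₂ (inj₂ refl)) _ rewrite position-p | position-r =
      mk⇔ (⊥-elim ∘ ¬pr) (λ { (_ , s≤s ()) })
    Adj⇔unitOverlap (inj₂ (inj₂ refl)) (inj₁ refl) _ rewrite position-p | position-r =
      mk⇔ (⊥-elim ∘ ¬pr ∘ Adj-sym) (λ { (s≤s () , _) })

    inducedP3-interval : (Z : Subset n) → (∀ x → x ∈ Z → OnPath x) → IsInterval G Z
    inducedP3-interval Z Z⊆path =
      position , suc ∘ position , (λ v _ → n≤1+n (position v)) ,
      λ x y x∈Z y∈Z → Adj⇔unitOverlap (Z⊆path x x∈Z) (Z⊆path y y∈Z)

  module _ {Z : Subset n} (L R : Fin n → ℕ)
           (Adj⇔overlap : ∀ x y → x ∈ Z → y ∈ Z → x ≢ y → Adj G x y ⇔ (L x ≤ R y × L y ≤ R x)) where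

    nonAdj⇒separated : ∀ {x y} → x ∈ Z → y ∈ Z → x ≢ y → ¬ Adj G x y → R x < L y ⊎ R y < L x
    nonAdj⇒separated {x} {y} x∈Z y∈Z x≢y ¬xy with L x ≤? R y | L y ≤? R x
    ... | yes Lx≤Ry | yes Ly≤Rx = ⊥-elim (¬xy (from (Adj⇔overlap x y x∈Z y∈Z x≢y) (Lx≤Ry , Ly≤Rx)))
    ... | no Lx≰Ry | _ = inj₂ (≰⇒> Lx≰Ry)
    ... | _ | no Ly≰Rx = inj₁ (≰⇒> Ly≰Rx)

    leftEnd≤rightEnd : ∀ {x y} → x ∈ Z → y ∈ Z → Adj G x y → L x ≤ R y
    leftEnd≤rightEnd x∈Z y∈Z xy = proj₁ (to (Adj⇔overlap _ _ x∈Z y∈Z (Adj-irrefl xy)) xy)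

    commonNbrs-of-separated-adjacent : ∀ {x y a b} → x ∈ Z → y ∈ Z → a ∈ Z → b ∈ Z → a ≢ b →
      R x < L y → Adj G a x → Adj G a y → Adj G b x → Adj G b y → Adj G a b
    commonNbrs-of-separated-adjacent x∈Z y∈Z a∈Z b∈Z a≢b Rx<Ly ax ay bx by =
      from (Adj⇔overlap _ _ a∈Z b∈Z a≢b) (spans a∈Z b∈Z ax by , spans b∈Z a∈Z bx ay)
      where
      spans : ∀ {c d} → c ∈ Z → d ∈ Z → Adj G c _ → Adj G d _ → L c ≤ R d
      spans c∈Z d∈Z cx dy = ≤-trans (leftEnd≤rightEnd c∈Z x∈Z cx)
        (≤-trans (<⇒≤ Rx<Ly) (leftEnd≤rightEnd y∈Z d∈Z (Adj-sym dy)))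

  record InducedC4 (u a v b : Fin n) : Set where
    field
      ua : Adj G u a
      av : Adj G a v
      vb : Adj G v b
      bu : Adj G b u
      ¬uv : ¬ Adj G u v
      ¬ab : ¬ Adj G a b
      u≢v : u ≢ v
      a≢b : a ≢ b

  OnC4 : Fin n → Fin n → Fin n → Fin n → Fin n → Set
  OnC4 u a v b x = x ≡ u ⊎ x ≡ a ⊎ x ≡ v ⊎ x ≡ b

  module _ {u a v b : Fin n} where

    rotate : InducedC4 u a v b → InducedC4 a v b u
    rotate C = record
      { ua = av ; av = vb ; vb = bu ; bu = ua
      ; ¬uv = ¬ab ; ¬ab = ¬uv ∘ Adj-sym ; u≢v = a≢b ; a≢b = u≢v ∘ sym }
      where open InducedC4 C

    rotate-OnC4 : ∀ {x} → OnC4 u a v b x → OnC4 a v b u x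
    rotate-OnC4 (inj₁ x≡u) = inj₂ (inj₂ (inj₂ x≡u))
    rotate-OnC4 (inj₂ x∈avb) = map₂ (map₂ inj₁) x∈avb

  C4-vertices : Fin n → Fin n → Fin n → Fin n → Subset n
  C4-vertices u a v b = ⁅ u ⁆ ∪ ⁅ a ⁆ ∪ ⁅ v ⁆ ∪ ⁅ b ⁆

  module _ {u a v b : Fin n} where

    ∣C4-vertices∣≤4 : ∣ C4-vertices u a v b ∣ ≤ 4
    ∣C4-vertices∣≤4 = ≤-trans (∣⁅x⁆∪p∣≤1+∣p∣ u _) (s≤s (≤-trans (∣⁅x⁆∪p∣≤1+∣p∣ a _)
      (s≤s (≤-trans (∣⁅x⁆∪p∣≤1+∣p∣ v _) (s≤s (≤-reflexive (∣⁅x⁆∣≡1 b)))))))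

    ∈C4-vertices⁻ : ∀ {x} → x ∈ C4-vertices u a v b → OnC4 u a v b x
    ∈C4-vertices⁻ x∈ with x∈⁅y⁆∪p⁻ _ x∈
    ... | inj₁ x≡u = inj₁ x≡u
    ... | inj₂ x∈avb with x∈⁅y⁆∪p⁻ _ x∈avb
    ...   | inj₁ x≡a = inj₂ (inj₁ x≡a)
    ...   | inj₂ x∈vb = inj₂ (inj₂ (map₂ (x∈⁅y⁆⇒x≡y b) (x∈⁅y⁆∪p⁻ _ x∈vb)))

    ∈C4-vertices⁺ : ∀ {x} → OnC4 u a v b x → x ∈ C4-vertices u a v b
    ∈C4-vertices⁺ (inj₁ refl) = x∈⁅x⁆∪p u _
    ∈C4-vertices⁺ (inj₂ (inj₁ refl)) = x∈p⇒x∈⁅y⁆∪p u (x∈⁅x⁆∪p a _)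
    ∈C4-vertices⁺ (inj₂ (inj₂ (inj₁ refl))) = x∈p⇒x∈⁅y⁆∪p u (x∈p⇒x∈⁅y⁆∪p a (x∈⁅x⁆∪p v _))
    ∈C4-vertices⁺ (inj₂ (inj₂ (inj₂ refl))) =
      x∈p⇒x∈⁅y⁆∪p u (x∈p⇒x∈⁅y⁆∪p a (x∈p⇒x∈⁅y⁆∪p v (x∈⁅x⁆ b)))

  inducedC4-notInterval : ∀ {u a v b} → InducedC4 u a v b → ¬ IsInterval G (C4-vertices u a v b)
  inducedC4-notInterval {u} {a} {v} {b} C (L , R , _ , Adj⇔overlap) =
    [ separatedBy (inj₁ refl) (inj₂ (inj₂ (inj₁ refl))) (Adj-sym ua) av bu (Adj-sym vb)
    , separatedBy (inj₂ (inj₂ (inj₁ refl))) (inj₁ refl) av (Adj-sym ua) (Adj-sym vb) bu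
    ] (nonAdj⇒separated L R Adj⇔overlap
         (∈C4-vertices⁺ (inj₁ refl)) (∈C4-vertices⁺ (inj₂ (inj₂ (inj₁ refl)))) u≢v ¬uv)
    where
    open InducedC4 C
    separatedBy : ∀ {x y} → OnC4 u a v b x → OnC4 u a v b y →
      Adj G a x → Adj G a y → Adj G b x → Adj G b y → R x < L y → ⊥
    separatedBy x∈ y∈ ax ay bx by Rx<Ly = ¬ab (commonNbrs-of-separated-adjacent L R Adj⇔overlap
      (∈C4-vertices⁺ x∈) (∈C4-vertices⁺ y∈)
      (∈C4-vertices⁺ (inj₂ (inj₁ refl))) (∈C4-vertices⁺ (inj₂ (inj₂ (inj₂ refl)))) a≢b Rx<Ly ax ay bx by)

  inducedC4-minus-first-interval : ∀ {u a v b} → InducedC4 u a v b →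
    (Z : Subset n) → (∀ x → x ∈ Z → OnC4 u a v b x) → u ∉ Z → IsInterval G Z
  inducedC4-minus-first-interval C Z Z⊆C4 u∉Z =
    inducedP3-interval av vb ¬ab a≢b Z λ x x∈Z → dropFirst x∈Z (Z⊆C4 x x∈Z)
    where
    open InducedC4 C
    dropFirst : ∀ {x} → x ∈ Z → OnC4 _ _ _ _ x → OnPath av vb ¬ab a≢b x
    dropFirst x∈Z (inj₁ refl) = ⊥-elim (u∉Z x∈Z)
    dropFirst _ (inj₂ x∈avb) = x∈avb

  inducedC4-minus-vertex-interval : ∀ {u a v b w} → InducedC4 u a v b → OnC4 u a v b w →
    (Z : Subset n) → (∀ x → x ∈ Z → OnC4 u a v b x) → w ∉ Z → IsInterval G Z
  inducedC4-minus-vertex-interval C (inj₁ refl) Z Z⊆C4 =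
    inducedC4-minus-first-interval C Z Z⊆C4
  inducedC4-minus-vertex-interval C (inj₂ (inj₁ refl)) Z Z⊆C4 =
    inducedC4-minus-first-interval (rotate C) Z (λ x → rotate-OnC4 ∘ Z⊆C4 x)
  inducedC4-minus-vertex-interval C (inj₂ (inj₂ (inj₁ refl))) Z Z⊆C4 =
    inducedC4-minus-first-interval (rotate (rotate C)) Z (λ x → rotate-OnC4 ∘ rotate-OnC4 ∘ Z⊆C4 x)
  inducedC4-minus-vertex-interval C (inj₂ (inj₂ (inj₂ refl))) Z Z⊆C4 =
    inducedC4-minus-first-interval (rotate (rotate (rotate C))) Z
      (λ x → rotate-OnC4 ∘ rotate-OnC4 ∘ rotate-OnC4 ∘ Z⊆C4 x)

  inducedC4-minimalForbidden : ∀ {u a v b} → InducedC4 u a v b →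
    IsMinimalForbidden G (C4-vertices u a v b)
  inducedC4-minimalForbidden C =
    inducedC4-notInterval C ,
    λ { Z (Z⊆Y , w , w∈Y , w∉Z) →
      inducedC4-minus-vertex-interval C (∈C4-vertices⁻ w∈Y) Z (λ x → ∈C4-vertices⁻ ∘ Z⊆Y) w∉Z }

  prereduced⇒noInducedC4 : Prereduced G → ∀ {u a v b} → ¬ InducedC4 u a v b
  prereduced⇒noInducedC4 prereduced {u} {a} {v} {b} C =
    from-no (11 ≤? 4)
      (≤-trans (prereduced _ (inducedC4-minimalForbidden C)) (∣C4-vertices∣≤4 {u} {a} {v} {b}))

  HasNonEdge : Subset n → Set
  HasNonEdge X = ∃[ a ] ∃[ b ] a ∈ X × b ∈ X × a ≢ b × ¬ Adj G a b

  enumerated-nonEdge : ∀ {k c X} → Enumerates G k c X → ∀ {i j} → i ≢ j → ¬ Adj G (c i) (c j) →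
    HasNonEdge X
  enumerated-nonEdge (injective , c∈X , _) i≢j ¬adj =
    _ , _ , c∈X _ , c∈X _ , i≢j ∘ injective _ _ , ¬adj

  hole⇒nonEdge : ∀ {X} → IsHole G X → HasNonEdge X
  hole⇒nonEdge (_ , c , s≤s (s≤s (s≤s (s≤s _))) , enum , Adj⇔cyclic) =
    enumerated-nonEdge enum {zero} {suc (suc zero)} (λ ()) (notCyclic ∘ to (Adj⇔cyclic _ _))
    where
    notCyclic : ¬ (CycSucc _ zero (suc (suc zero)) ⊎ CycSucc _ (suc (suc zero)) zero)
    notCyclic (inj₁ (inj₁ ()))
    notCyclic (inj₁ (inj₂ (() , _)))
    notCyclic (inj₂ (inj₁ ()))
    notCyclic (inj₂ (inj₂ (() , _)))

  longPath⇒nonEdge : ∀ {X} → IsLongPath G X → HasNonEdge X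
  longPath⇒nonEdge (_ , c , s≤s (s≤s (s≤s _)) , enum , Adj⇔consecutive) =
    enumerated-nonEdge enum {zero} {suc (suc zero)} (λ ()) (notConsecutive ∘ to (Adj⇔consecutive _ _))
    where
    notConsecutive : ¬ (1 ≡ 2 ⊎ 3 ≡ 0)
    notConsecutive (inj₁ ())
    notConsecutive (inj₂ ())

  walk-start : ∀ {P x y} → Walk G P x y → P x
  walk-start (here Px) = Px
  walk-start (step Px _ _) = Px

  asteroidalTriple⇒nonEdge : ∀ {X} → HasAT G X → HasNonEdge X
  asteroidalTriple⇒nonEdge (a , b , _ , a∈X , b∈X , _ , _ , _ , _ , _ , b⇝c , _)
    with _ , b≢a , ¬ab ← walk-start b⇝c = a , b , a∈X , b∈X , b≢a ∘ sym , ¬ab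

  nonEdge⇒commonNbrs-clique : Prereduced G → ∀ {X} → HasNonEdge X → IsCliqueSet G (CommonNbr G X)
  nonEdge⇒commonNbrs-clique prereduced (a , b , a∈X , b∈X , a≢b , ¬ab) u v u∼X v∼X u≢v
    with E u v Bool.≟ Bool.true
  ... | yes uv = uv
  ... | no ¬uv = ⊥-elim (prereduced⇒noInducedC4 prereduced record
    { ua = u∼X a a∈X ; av = Adj-sym (v∼X a a∈X) ; vb = v∼X b b∈X ; bu = Adj-sym (u∼X b b∈X)
    ; ¬uv = ¬uv ; ¬ab = ¬ab ; u≢v = u≢v ; a≢b = a≢b })

proposition4p3 : (G : Graph) → Prereduced G → (X : Subset (Graph.n G)) →
    IsHole G X ⊎ IsAsteroidalWitness G X ⊎ IsLongPath G X →
    IsCliqueSet G (CommonNbr G X)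
proposition4p3 G prereduced _ =
  nonEdge⇒commonNbrs-clique G prereduced ∘
  [ hole⇒nonEdge G , [ asteroidalTriple⇒nonEdge G ∘ proj₁ ∘ proj₂ , longPath⇒nonEdge G ] ]
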